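{- For any modal formula $A$ in the language with the single modal operator $\Box$, $\mathbf{NR} \vdash A$ if and only if $\mathsf{GR} \vdash A^{\blacksquare}$, where $A^{\blacksquare}$ is obtained from $A$ by replacing every occurrence of $\Box$ with $\blacksquare$.
   Context: Modal formulas are built from propositional variables and $\bot$ using $\neg,\land,\lor,\to$ and $\Box$. $\mathbf{N}$ has all propositional tautologies as axioms and Modus Ponens and Necessitation $A/\Box A$ as rules; $\mathbf{NR}$ is $\mathbf{N}$ plus the rule $\neg B/\neg\Box B$. $\mathsf{GR}$ (Shavrukov's bimodal logic) is formulated in the language $\mathcal{L}(\Box,\blacksquare)$ with two modal operators; its axioms are all propositional tautologies, $\Box(A\to B)\to(\Box A\to\Box B)$, $\Box(\Box A \to A)\to\Box A$, $\blacksquare A \to \Box A$, $\Box A \to \Box\blacksquare A$, $\Box A \to (\Box\bot \lor \blacksquare A)$, and $\Box\neg A \to \Box\neg\blacksquare A$ (for all $\mathcal{L}(\Box,\blacksquare)$-formulas $A,B$); its rules are Modus Ponens, $A/\Box A$, and $\Box A / A$. -}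

module Defs where

open import Data.Nat using (ℕ)
open import Data.Bool using (Bool; true; false; not; _∧_; _∨_)

infixr 5 _⇒_
infixr 6 _∨'_
infixr 7 _∧'_
infix 8 ¬'_ □_ ■_
infix 4 NR⊢_ GR⊢_

data Fm : Set where
  var  : ℕ → Fm
  ⊥'   : Fm
  ¬'_  : Fm → Fm
  _∧'_ : Fm → Fm → Fm
  _∨'_ : Fm → Fm → Fm
  _⇒_  : Fm → Fm → Fm
  □_   : Fm → Fm

data BFm : Set where
  var  : ℕ → BFm
  ⊥'   : BFm
  ¬'_  : BFm → BFm
  _∧'_ : BFm → BFm → BFm
  _∨'_ : BFm → BFm → BFm
  _⇒_  : BFm → BFm → BFm
  □_   : BFm → BFm
  ■_   : BFm → BFm

_⊃_ : Bool → Bool → Bool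
a ⊃ b = not a ∨ b

-- Boolean evaluation: modal subformulas are treated as propositional atoms,
-- their truth value being given by the valuation on the formula itself.
record Val : Set where
  field
    atom : ℕ → Bool
    box  : Fm → Bool

eval : Val → Fm → Bool
eval v (var n)  = Val.atom v n
eval v ⊥'       = false
eval v (¬' a)   = not (eval v a)
eval v (a ∧' b) = eval v a ∧ eval v b
eval v (a ∨' b) = eval v a ∨ eval v b
eval v (a ⇒ b)  = eval v a ⊃ eval v b
eval v (□ a)    = Val.box v a

record BVal : Set where
  field
    atom : ℕ → Bool
    box  : BFm → Bool
    bbox : BFm → Bool

beval : BVal → BFm → Bool
beval v (var n)  = BVal.atom v n
beval v ⊥'       = false
beval v (¬' a)   = not (beval v a)
beval v (a ∧' b) = beval v a ∧ beval v b
beval v (a ∨' b) = beval v a ∨ beval v b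
beval v (a ⇒ b)  = beval v a ⊃ beval v b
beval v (□ a)    = BVal.box v a
beval v (■ a)    = BVal.bbox v a

Taut : Fm → Set
Taut a = (v : Val) → eval v a ≡ true
  where open import Relation.Binary.PropositionalEquality using (_≡_)

BTaut : BFm → Set
BTaut a = (v : BVal) → beval v a ≡ true
  where open import Relation.Binary.PropositionalEquality using (_≡_)

data NR⊢_ : Fm → Set where
  taut : ∀ {A} → Taut A → NR⊢ A
  mp   : ∀ {A B} → NR⊢ (A ⇒ B) → NR⊢ A → NR⊢ B
  nec  : ∀ {A} → NR⊢ A → NR⊢ (□ A)
  ros  : ∀ {B} → NR⊢ (¬' B) → NR⊢ (¬' (□ B))

data GR⊢_ : BFm → Set where
  taut  : ∀ {A} → BTaut A → GR⊢ A
  axK   : ∀ {A B} → GR⊢ (□ (A ⇒ B) ⇒ (□ A ⇒ □ B))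
  axL   : ∀ {A} → GR⊢ (□ (□ A ⇒ A) ⇒ □ A)
  ax■□  : ∀ {A} → GR⊢ (■ A ⇒ □ A)
  ax□□■ : ∀ {A} → GR⊢ (□ A ⇒ □ (■ A))
  ax□⊥■ : ∀ {A} → GR⊢ (□ A ⇒ (□ ⊥' ∨' ■ A))
  ax¬■  : ∀ {A} → GR⊢ (□ (¬' A) ⇒ □ (¬' (■ A)))
  mp    : ∀ {A B} → GR⊢ (A ⇒ B) → GR⊢ A → GR⊢ B
  nec   : ∀ {A} → GR⊢ A → GR⊢ (□ A)
  refl□ : ∀ {A} → GR⊢ (□ A) → GR⊢ A

_■ : Fm → BFm
(var n)  ■ = var n
⊥'       ■ = ⊥'
(¬' a)   ■ = ¬' (a ■)
(a ∧' b) ■ = (a ■) ∧' (b ■)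
(a ∨' b) ■ = (a ■) ∨' (b ■)
(a ⇒ b)  ■ = (a ■) ⇒ (b ■)
(□ a)    ■ = ■ (a ■)

-- Forward: under A ↦ A^■ the NR rules become derivable in GR: Necessitation via
-- □A → □■A and the rule ¬B/¬□B via □¬A → □¬■A, each followed by the rule □A/A.
--
-- Backward: read bimodal formulas unimodally by □ ↦ ⊤ and ■ ↦ □. This sends A^■
-- back to A, so it suffices that NR proves the translation of every GR theorem.
-- The rule □A/A loses the information carried by the translation, so the
-- induction also keeps track of truth in a chain of Boolean valuations: at
-- world k, both □X and ■X mean "NR proves the translation of X, and X holds at
-- every world j < k". The chain is converse well-founded, so Löb's axiom holds,
-- and every GR theorem is true at every world. Defining these valuations needs
-- NR-provability to be decidable: NR proves A iff A holds in every valuation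
-- making □X true when NR ⊢ X and false when NR ⊢ ¬X, which is a finite check
-- once these side conditions are decided for the (smaller) modal atoms of A.
module Submission where

open import Defs
open import Data.Bool using (Bool; true; false; not; _∧_; _∨_; if_then_else_)
open import Data.Bool.Properties using (∨-zeroʳ; ∧-conicalˡ; ∧-conicalʳ; not-injective; not-¬; ¬-not)
open import Data.Empty using (⊥; ⊥-elim)
open import Data.List using (List; []; _∷_; _++_; map)
import Data.List.Properties as List
open import Data.List.Membership.Propositional using (_∈_)
open import Data.List.Membership.Propositional.Properties using (∈-++⁺ˡ; ∈-++⁺ʳ)
open import Data.List.Relation.Unary.All using (All; []; _∷_)
import Data.List.Relation.Unary.All.Properties as All
open import Data.List.Relation.Unary.Any using (here; there)
open import Data.Nat using (ℕ; zero; suc)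
import Data.Nat.Properties as ℕ
open import Data.Product using (Σ; _×_; _,_; proj₁; proj₂; uncurry)
open import Data.Sum using (_⊎_; inj₁; inj₂; [_,_]; map₁)
import Data.Sum.Properties as Sum
open import Data.Unit using (⊤; tt)
open import Function using (_∘_; id)
open import Function.Bundles using (_⇔_; mk⇔)
open import Relation.Binary.Definitions using (DecidableEquality)
open import Relation.Binary.PropositionalEquality using (_≡_; refl; sym; trans; cong; cong₂; subst; module ≡-Reasoning)
open import Relation.Nullary using (Dec; yes; no; does)
open import Relation.Nullary.Decidable using (map′; dec-true)

⊃-elim : ∀ {a b} → a ⊃ b ≡ true → a ≡ true → b ≡ true
⊃-elim e refl = e

⊃-intro : ∀ {a b} → (a ≡ true → b ≡ true) → a ⊃ b ≡ true
⊃-intro {true}  f = f refl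
⊃-intro {false} f = refl

⊃-cases : ∀ p g → (p ⊃ g) ⊃ ((not p ⊃ g) ⊃ g) ≡ true
⊃-cases true  true  = refl
⊃-cases true  false = refl
⊃-cases false true  = refl
⊃-cases false false = refl

does-true : ∀ {P : Set} (p? : Dec P) → does p? ≡ true → P
does-true (yes p) _ = p

-- From NR to GR

■-view : BVal → Val
■-view v = record { atom = BVal.atom v ; box = λ A → BVal.bbox v (A ■) }

eval-■ : ∀ v A → eval (■-view v) A ≡ beval v (A ■)
eval-■ v (var n)  = refl
eval-■ v ⊥'       = refl
eval-■ v (¬' a)   = cong not (eval-■ v a)
eval-■ v (a ∧' b) = cong₂ _∧_ (eval-■ v a) (eval-■ v b)
eval-■ v (a ∨' b) = cong₂ _∨_ (eval-■ v a) (eval-■ v b)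
eval-■ v (a ⇒ b)  = cong₂ _⊃_ (eval-■ v a) (eval-■ v b)
eval-■ v (□ a)    = refl

■-sound : ∀ {A} → NR⊢ A → GR⊢ (A ■)
■-sound (taut {A} t) = taut λ v → trans (sym (eval-■ v A)) (t (■-view v))
■-sound (mp p q)     = mp (■-sound p) (■-sound q)
■-sound (nec p)      = refl□ (mp ax□□■ (nec (■-sound p)))
■-sound (ros p)      = refl□ (mp ax¬■ (nec (■-sound p)))

-- NR is sound for the one-point reflexive model with all variables false,
-- hence consistent.
collapse : Fm → Bool
collapse (var n)  = false
collapse ⊥'       = false
collapse (¬' a)   = not (collapse a)
collapse (a ∧' b) = collapse a ∧ collapse b
collapse (a ∨' b) = collapse a ∨ collapse b
collapse (a ⇒ b)  = collapse a ⊃ collapse b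
collapse (□ a)    = collapse a

collapse-sound : ∀ {A} → NR⊢ A → collapse A ≡ true
collapse-sound (taut {A} t) = trans (sym (eval-collapse A)) (t collapsed)
  where
  collapsed : Val
  collapsed = record { atom = λ _ → false ; box = collapse }

  eval-collapse : ∀ A → eval collapsed A ≡ collapse A
  eval-collapse (var n)  = refl
  eval-collapse ⊥'       = refl
  eval-collapse (¬' a)   = cong not (eval-collapse a)
  eval-collapse (a ∧' b) = cong₂ _∧_ (eval-collapse a) (eval-collapse b)
  eval-collapse (a ∨' b) = cong₂ _∨_ (eval-collapse a) (eval-collapse b)
  eval-collapse (a ⇒ b)  = cong₂ _⊃_ (eval-collapse a) (eval-collapse b)
  eval-collapse (□ a)    = refl
collapse-sound (mp p q) = ⊃-elim (collapse-sound p) (collapse-sound q)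
collapse-sound (nec p)  = collapse-sound p
collapse-sound (ros p)  = collapse-sound p

NR-consistent : ∀ {X} → NR⊢ X → NR⊢ (¬' X) → ⊥
NR-consistent p q = not-¬ (collapse-sound p) (not-injective (collapse-sound q))

Admissible : Fm → Bool → Set
Admissible X b = (NR⊢ X → b ≡ true) × (NR⊢ (¬' X) → b ≡ false)

collapse-admissible : ∀ X → Admissible X (collapse X)
collapse-admissible X = collapse-sound , not-injective ∘ collapse-sound

Adequate : Val → Set
Adequate V = ∀ X → Admissible X (Val.box V X)

NR-sound : ∀ {A} → NR⊢ A → ∀ {V} → Adequate V → eval V A ≡ true
NR-sound (taut t)     {V} adequate = t V
NR-sound (mp p q)         adequate = ⊃-elim (NR-sound p adequate) (NR-sound q adequate)
NR-sound (nec {A} p)      adequate = proj₁ (adequate A) p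
NR-sound (ros {B} p)      adequate = cong not (proj₂ (adequate B) p)

-- Deciding NR

-- A formula is determined by its postfix code, which a stack machine reads back.
code : Fm → List ℕ → List ℕ
code (var n)  ns = 0 ∷ n ∷ ns
code ⊥'       ns = 1 ∷ ns
code (¬' a)   ns = code a (2 ∷ ns)
code (a ∧' b) ns = code a (code b (3 ∷ ns))
code (a ∨' b) ns = code a (code b (4 ∷ ns))
code (a ⇒ b)  ns = code a (code b (5 ∷ ns))
code (□ a)    ns = code a (6 ∷ ns)

run : List ℕ → List Fm → List Fm
run []           s           = s
run (0 ∷ n ∷ ns) s           = run ns (var n ∷ s)
run (1 ∷ ns)     s           = run ns (⊥' ∷ s)
run (2 ∷ ns)     (a ∷ s)     = run ns (¬' a ∷ s)
run (3 ∷ ns)     (b ∷ a ∷ s) = run ns (a ∧' b ∷ s)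
run (4 ∷ ns)     (b ∷ a ∷ s) = run ns (a ∨' b ∷ s)
run (5 ∷ ns)     (b ∷ a ∷ s) = run ns ((a ⇒ b) ∷ s)
run (6 ∷ ns)     (a ∷ s)     = run ns (□ a ∷ s)
run (_ ∷ ns)     s           = run ns s

run-code : ∀ a ns s → run (code a ns) s ≡ run ns (a ∷ s)
run-code (var n)  ns s = refl
run-code ⊥'       ns s = refl
run-code (¬' a)   ns s = run-code a (2 ∷ ns) s
run-code (a ∧' b) ns s = trans (run-code a _ s) (run-code b (3 ∷ ns) (a ∷ s))
run-code (a ∨' b) ns s = trans (run-code a _ s) (run-code b (4 ∷ ns) (a ∷ s))
run-code (a ⇒ b)  ns s = trans (run-code a _ s) (run-code b (5 ∷ ns) (a ∷ s))
run-code (□ a)    ns s = run-code a (6 ∷ ns) s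

code-injective : ∀ {a b} → code a [] ≡ code b [] → a ≡ b
code-injective {a} {b} e = List.∷-injectiveˡ (begin
  a ∷ []             ≡⟨ sym (run-code a [] []) ⟩
  run (code a []) [] ≡⟨ cong (λ ns → run ns []) e ⟩
  run (code b []) [] ≡⟨ run-code b [] [] ⟩
  b ∷ []             ∎)
  where open ≡-Reasoning

_≟F_ : DecidableEquality Fm
a ≟F b = map′ code-injective (cong (λ c → code c [])) (List.≡-dec ℕ._≟_ (code a []) (code b []))

At : Set
At = ℕ ⊎ Fm

⌜_⌝ : At → Fm
⌜ inj₁ n ⌝ = var n
⌜ inj₂ X ⌝ = □ X

_≟A_ : DecidableEquality At
_≟A_ = Sum.≡-dec ℕ._≟_ _≟F_

atoms : Fm → List At
atoms (var n)  = inj₁ n ∷ []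
atoms ⊥'       = []
atoms (¬' a)   = atoms a
atoms (a ∧' b) = atoms a ++ atoms b
atoms (a ∨' b) = atoms a ++ atoms b
atoms (a ⇒ b)  = atoms a ++ atoms b
atoms (□ a)    = inj₂ a ∷ []

eval-atoms : ∀ A {v w} → (∀ {a} → a ∈ atoms A → eval v ⌜ a ⌝ ≡ eval w ⌜ a ⌝) → eval v A ≡ eval w A
eval-atoms (var n)  h = h (here refl)
eval-atoms ⊥'       h = refl
eval-atoms (¬' a)   h = cong not (eval-atoms a h)
eval-atoms (a ∧' b) h = cong₂ _∧_ (eval-atoms a (h ∘ ∈-++⁺ˡ)) (eval-atoms b (h ∘ ∈-++⁺ʳ (atoms a)))
eval-atoms (a ∨' b) h = cong₂ _∨_ (eval-atoms a (h ∘ ∈-++⁺ˡ)) (eval-atoms b (h ∘ ∈-++⁺ʳ (atoms a)))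
eval-atoms (a ⇒ b)  h = cong₂ _⊃_ (eval-atoms a (h ∘ ∈-++⁺ˡ)) (eval-atoms b (h ∘ ∈-++⁺ʳ (atoms a)))
eval-atoms (□ a)    h = h (here refl)

valuation : (At → Bool) → Val
valuation f = record { atom = f ∘ inj₁ ; box = f ∘ inj₂ }

eval-valuation : ∀ f a → eval (valuation f) ⌜ a ⌝ ≡ f a
eval-valuation f (inj₁ n) = refl
eval-valuation f (inj₂ X) = refl

Literal : Set
Literal = At × Bool

⟨_⟩ : Literal → Fm
⟨ a , true  ⟩ = ⌜ a ⌝
⟨ a , false ⟩ = ¬' ⌜ a ⌝

eval-⟨⟩ : ∀ {v} l → eval v ⟨ l ⟩ ≡ true → eval v ⌜ proj₁ l ⌝ ≡ proj₂ l
eval-⟨⟩ (a , true)  e = e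
eval-⟨⟩ (a , false) e = not-injective e

infixr 5 _⇒*_
_⇒*_ : List Literal → Fm → Fm
[]      ⇒* A = A
(l ∷ σ) ⇒* A = ⟨ l ⟩ ⇒ σ ⇒* A

Satisfies : Val → List Literal → Set
Satisfies v = All (λ l → eval v ⟨ l ⟩ ≡ true)

eval-⇒* : ∀ σ {v A} → (Satisfies v σ → eval v A ≡ true) → eval v (σ ⇒* A) ≡ true
eval-⇒* []      h = h []
eval-⇒* (l ∷ σ) h = ⊃-intro λ e → eval-⇒* σ (h ∘ (e ∷_))

⇒*-cases : ∀ a σ {A} → NR⊢ ((a , true) ∷ σ) ⇒* A → NR⊢ ((a , false) ∷ σ) ⇒* A → NR⊢ σ ⇒* A
⇒*-cases a σ p q = mp (mp (taut λ v → ⊃-cases (eval v ⌜ a ⌝) _) p) q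

-- Unassigned boxes take their collapsed value, which is admissible.
assign : List Literal → At → Bool
assign []            (inj₁ n) = false
assign []            (inj₂ X) = collapse X
assign ((a , b) ∷ σ) c        = if does (a ≟A c) then b else assign σ c

assign-satisfied : ∀ {v σ a} → Satisfies v σ → a ∈ map proj₁ σ → eval v ⌜ a ⌝ ≡ assign σ a
assign-satisfied {σ = (x , b) ∷ σ} {a} (s ∷ ss) a∈ with x ≟A a | a∈
... | yes refl | _        = eval-⟨⟩ (x , b) s
... | no x≢a   | here a≡x = ⊥-elim (x≢a (sym a≡x))
... | no _     | there a∈ = assign-satisfied ss a∈

⇒*-taut : ∀ σ A → (∀ {a} → a ∈ atoms A → a ∈ map proj₁ σ) →
          eval (valuation (assign σ)) A ≡ true → Taut (σ ⇒* A)
⇒*-taut σ A covered e v = eval-⇒* σ λ s →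
  trans (eval-atoms A λ {a} a∈ → trans (assign-satisfied s (covered a∈)) (sym (eval-valuation (assign σ) a))) e

Admissibleᴬ : At → Bool → Set
Admissibleᴬ (inj₁ _) _ = ⊤
Admissibleᴬ (inj₂ X) b = Admissible X b

assign-admissible : ∀ {σ} → All (uncurry Admissibleᴬ) σ → ∀ c → Admissibleᴬ c (assign σ c)
assign-admissible []                      (inj₁ n) = tt
assign-admissible []                      (inj₂ X) = collapse-admissible X
assign-admissible {(a , b) ∷ σ} (ok ∷ oks) c with a ≟A c
... | yes refl = ok
... | no _     = assign-admissible oks c

data Status (a : At) : Set where
  forced : ∀ b → NR⊢ ⟨ a , b ⟩ → Admissibleᴬ a b → Status a
  free   : (∀ b → Admissibleᴬ a b) → Status a

box-status : ∀ {X} → Dec (NR⊢ X) → Dec (NR⊢ (¬' X)) → Status (inj₂ X)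
box-status (yes p)  _        = forced true (nec p) ((λ _ → refl) , ⊥-elim ∘ NR-consistent p)
box-status (no ¬p)  (yes q)  = forced false (ros q) (⊥-elim ∘ ¬p , λ _ → refl)
box-status (no ¬p)  (no ¬q)  = free λ _ → ⊥-elim ∘ ¬p , ⊥-elim ∘ ¬q

Countermodel : Fm → Set
Countermodel A = Σ Val λ V → Adequate V × eval V A ≡ false

Covered : Fm → List At → List Literal → Set
Covered A L σ = ∀ {a} → a ∈ atoms A → a ∈ L ⊎ a ∈ map proj₁ σ

covered-∷ : ∀ A {a L σ} b → Covered A (a ∷ L) σ → Covered A L ((a , b) ∷ σ)
covered-∷ A b covered a∈ with covered a∈
... | inj₁ (here refl) = inj₂ (here refl)
... | inj₁ (there a∈L) = inj₁ a∈L
... | inj₂ a∈σ         = inj₂ (there a∈σ)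

search : ∀ A L → All Status L → ∀ σ → All (uncurry Admissibleᴬ) σ → Covered A L σ →
         NR⊢ σ ⇒* A ⊎ Countermodel A
search A [] [] σ oks covered with eval (valuation (assign σ)) A in e
... | true  = inj₁ (taut (⇒*-taut σ A ([ (λ ()) , id ] ∘ covered) e))
... | false = inj₂ (valuation (assign σ) , assign-admissible oks ∘ inj₂ , e)
search A (a ∷ L) (forced b ⊢a ok ∷ st) σ oks covered =
  map₁ (λ p → mp p ⊢a) (search A L st ((a , b) ∷ σ) (ok ∷ oks) (covered-∷ A b covered))
search A (a ∷ L) (free ok ∷ st) σ oks covered
  with search A L st ((a , true) ∷ σ) (ok true ∷ oks) (covered-∷ A true covered)
     | search A L st ((a , false) ∷ σ) (ok false ∷ oks) (covered-∷ A false covered)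
... | inj₁ p | inj₁ q = inj₁ (⇒*-cases a σ p q)
... | inj₂ c | _      = inj₂ c
... | inj₁ _ | inj₂ c = inj₂ c

decide : ∀ A → All Status (atoms A) → Dec (NR⊢ A)
decide A st with search A (atoms A) st [] [] inj₁
... | inj₁ p                   = yes p
... | inj₂ (V , adequate , e) = no λ p → not-¬ (NR-sound p adequate) e

statuses : ∀ A → All Status (atoms A)
statuses (var n)  = free (λ _ → tt) ∷ []
statuses ⊥'       = []
statuses (¬' a)   = statuses a
statuses (a ∧' b) = All.++⁺ (statuses a) (statuses b)
statuses (a ∨' b) = All.++⁺ (statuses a) (statuses b)
statuses (a ⇒ b)  = All.++⁺ (statuses a) (statuses b)
statuses (□ a)    = box-status (decide a (statuses a)) (decide (¬' a) (statuses a)) ∷ []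

NR-decidable : ∀ A → Dec (NR⊢ A)
NR-decidable A = decide A (statuses A)

-- From GR to NR

⊤' : Fm
⊤' = ¬' ⊥'

⊢⊤ : NR⊢ ⊤'
⊢⊤ = taut λ _ → refl

flatten : BFm → Fm
flatten (var n)  = var n
flatten ⊥'       = ⊥'
flatten (¬' a)   = ¬' flatten a
flatten (a ∧' b) = flatten a ∧' flatten b
flatten (a ∨' b) = flatten a ∨' flatten b
flatten (a ⇒ b)  = flatten a ⇒ flatten b
flatten (□ a)    = ⊤'
flatten (■ a)    = □ flatten a

flatten-■ : ∀ A → flatten (A ■) ≡ A
flatten-■ (var n)  = refl
flatten-■ ⊥'       = refl
flatten-■ (¬' a)   = cong ¬'_ (flatten-■ a)
flatten-■ (a ∧' b) = cong₂ _∧'_ (flatten-■ a) (flatten-■ b)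
flatten-■ (a ∨' b) = cong₂ _∨'_ (flatten-■ a) (flatten-■ b)
flatten-■ (a ⇒ b)  = cong₂ _⇒_ (flatten-■ a) (flatten-■ b)
flatten-■ (□ a)    = cong □_ (flatten-■ a)

flatten-view : Val → BVal
flatten-view v = record { atom = Val.atom v ; box = λ _ → true ; bbox = Val.box v ∘ flatten }

eval-flatten : ∀ v B → eval v (flatten B) ≡ beval (flatten-view v) B
eval-flatten v (var n)  = refl
eval-flatten v ⊥'       = refl
eval-flatten v (¬' a)   = cong not (eval-flatten v a)
eval-flatten v (a ∧' b) = cong₂ _∧_ (eval-flatten v a) (eval-flatten v b)
eval-flatten v (a ∨' b) = cong₂ _∨_ (eval-flatten v a) (eval-flatten v b)
eval-flatten v (a ⇒ b)  = cong₂ _⊃_ (eval-flatten v a) (eval-flatten v b)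
eval-flatten v (□ a)    = refl
eval-flatten v (■ a)    = refl

provable : BFm → Bool
provable X = does (NR-decidable (flatten X))

mutual
  Box : ℕ → BFm → Bool
  Box zero    X = provable X
  Box (suc k) X = Box k X ∧ beval (world k) X

  world : ℕ → BVal
  world k = record { atom = λ _ → false ; box = Box k ; bbox = Box k }

Box-suc : ∀ k X → Box k X ≡ true → beval (world k) X ≡ true → Box (suc k) X ≡ true
Box-suc k X = cong₂ _∧_

Box-suc⇒Box : ∀ k X → Box (suc k) X ≡ true → Box k X ≡ true
Box-suc⇒Box k X = ∧-conicalˡ (Box k X) _

Box-suc⇒true : ∀ k X → Box (suc k) X ≡ true → beval (world k) X ≡ true
Box-suc⇒true k X = ∧-conicalʳ (Box k X) _

Box-provable : ∀ k X → Box k X ≡ true → NR⊢ flatten X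
Box-provable zero    X = does-true (NR-decidable (flatten X))
Box-provable (suc k) X = Box-provable k X ∘ Box-suc⇒Box k X

Box-K : ∀ k A B → Box k (A ⇒ B) ≡ true → Box k A ≡ true → Box k B ≡ true
Box-K zero    A B e e′ = dec-true (NR-decidable _) (mp (Box-provable 0 (A ⇒ B) e) (Box-provable 0 A e′))
Box-K (suc k) A B e e′ = Box-suc k B
  (Box-K k A B (Box-suc⇒Box k (A ⇒ B) e) (Box-suc⇒Box k A e′))
  (⊃-elim (Box-suc⇒true k (A ⇒ B) e) (Box-suc⇒true k A e′))

Box-Löb : ∀ k A → Box k (□ A ⇒ A) ≡ true → Box k A ≡ true
Box-Löb zero    A e = dec-true (NR-decidable _) (mp (Box-provable 0 (□ A ⇒ A) e) ⊢⊤)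
Box-Löb (suc k) A e = Box-suc k A □A (⊃-elim (Box-suc⇒true k (□ A ⇒ A) e) □A)
  where □A = Box-Löb k A (Box-suc⇒Box k (□ A ⇒ A) e)

Box-■ : ∀ k A → Box k A ≡ true → Box k (■ A) ≡ true
Box-■ zero    A e = dec-true (NR-decidable _) (nec (Box-provable 0 A e))
Box-■ (suc k) A e = Box-suc k (■ A) (Box-■ k A (Box-suc⇒Box k A e)) (Box-suc⇒Box k A e)

Box-¬■ : ∀ k A → Box k (¬' A) ≡ true → Box k (¬' (■ A)) ≡ true
Box-¬■ zero    A e = dec-true (NR-decidable _) (ros (Box-provable 0 (¬' A) e))
-- □A fails at world k, as NR proves the negation of the translation of A.
Box-¬■ (suc k) A e = Box-suc k (¬' (■ A)) (Box-¬■ k A ¬A) (sym (¬-not λ t≡□A →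
  NR-consistent (Box-provable k A (sym t≡□A)) (Box-provable k (¬' A) ¬A)))
  where ¬A = Box-suc⇒Box k (¬' A) e

Valid : BFm → Set
Valid B = NR⊢ flatten B × (∀ k → beval (world k) B ≡ true)

Valid⇒Box : ∀ B → Valid B → ∀ k → Box k B ≡ true
Valid⇒Box B (p , _) zero    = dec-true (NR-decidable _) p
Valid⇒Box B (p , h) (suc k) = Box-suc k B (Valid⇒Box B (p , h) k) (h k)

GR-sound : ∀ {B} → GR⊢ B → Valid B
GR-sound (taut {B} t)  = taut (λ v → trans (eval-flatten v B) (t (flatten-view v))) , t ∘ world
GR-sound (axK {A} {B}) = taut (λ _ → refl) , λ k → ⊃-intro (⊃-intro ∘ Box-K k A B)
GR-sound (axL {A})     = taut (λ _ → refl) , λ k → ⊃-intro (Box-Löb k A)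
GR-sound (ax■□ {A})    = taut (λ _ → ∨-zeroʳ _) , λ k → ⊃-intro {Box k A} id
GR-sound (ax□□■ {A})   = taut (λ _ → refl) , λ k → ⊃-intro (Box-■ k A)
GR-sound (ax□⊥■ {A})   = taut (λ _ → refl) , λ k → ⊃-intro {Box k A} λ e → trans (cong (Box k ⊥' ∨_) e) (∨-zeroʳ _)
GR-sound (ax¬■ {A})    = taut (λ _ → refl) , λ k → ⊃-intro (Box-¬■ k A)
GR-sound (mp p q) with GR-sound p | GR-sound q
... | ⊢p , p-true | ⊢q , q-true = mp ⊢p ⊢q , λ k → ⊃-elim (p-true k) (q-true k)
GR-sound (nec {A} p)   = ⊢⊤ , Valid⇒Box A (GR-sound p)
GR-sound (refl□ {A} p) = Box-provable 0 A (true-in 0) , λ k → Box-suc⇒true k A (true-in (suc k))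
  where true-in = proj₂ (GR-sound p)

corollary6p3 : (A : Fm) → (NR⊢ A) ⇔ (GR⊢ (A ■))
corollary6p3 A = mk⇔ ■-sound λ ⊢A■ → subst NR⊢_ (flatten-■ A) (proj₁ (GR-sound ⊢A■))
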